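{- Let $M$, $X$, $e$, $f$, $B$, $C$, $A$, $M'$, $C'$, $A'$, $\omega$ be as in the context, and suppose $M'=M[I\,|\,C']$. Then for every $i\in X-e$ and $j\in (E-X)-f$, $A_{ij}=0$ if and only if $A'_{ij}=0$.
   Context: $M$ is a $\mathrm{GF}(4)$-representable matroid on $E$ with a circuit-hyperplane $X$; $e\in X$ and $f\in E-X$ are such that $B=(X-e)\cup f$ is a basis of $M$; and $M=M[I\,|\,C]$ where $C$ is a matrix over $\mathrm{GF}(4)$ with rows indexed by $B$ and columns by $E-B$ of block form $C=\begin{bmatrix}A&\underline1\\ \underline1^T&0\end{bmatrix}$ (rows $X-e$, then $f$; columns $(E-X)-f$, then $e$; $\underline1$ all-ones). $M'$ is the matroid obtained from $M$ by relaxing $X$ (bases $\mathcal{B}(M)\cup\{X\}$), and $C'=\begin{bmatrix}A'&\underline1\\ \underline1^T&\omega\end{bmatrix}$ is a matrix over $\mathrm{GF}(4)$ with the same row and column labels, $A'$ an $(X-e)\times((E-X)-f)$ matrix and $\omega\in\mathrm{GF}(4)-\{0,1\}$. Here $M[I\,|\,C]$ is the vector matroid of $[I\,|\,C]$ with identity columns labelled by the row labels $B$. -}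

module Defs where

open import Data.Nat using (ℕ; zero; suc)
open import Data.Fin using (Fin; _≟_)
open import Data.Maybe using (Maybe; just; nothing)
open import Data.Bool using (Bool; true; false)
open import Data.Product using (Σ; _×_; _,_)
open import Relation.Nullary using (¬_; yes; no)
open import Relation.Binary.PropositionalEquality using (_≡_)

-- The field GF(4) = {0, 1, a, b} with b = a² = a + 1.

data GF4 : Set where
  𝟎 𝟏 α β : GF4

infixl 6 _+₄_
infixl 7 _*₄_

_+₄_ : GF4 → GF4 → GF4
𝟎 +₄ y = y
x +₄ 𝟎 = x
𝟏 +₄ 𝟏 = 𝟎
𝟏 +₄ α = β
𝟏 +₄ β = α
α +₄ 𝟏 = β
α +₄ α = 𝟎
α +₄ β = 𝟏
β +₄ 𝟏 = α
β +₄ α = 𝟏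
β +₄ β = 𝟎

_*₄_ : GF4 → GF4 → GF4
𝟎 *₄ y = 𝟎
𝟏 *₄ y = y
α *₄ 𝟎 = 𝟎
α *₄ 𝟏 = α
α *₄ α = β
α *₄ β = 𝟏
β *₄ 𝟎 = 𝟎
β *₄ 𝟏 = β
β *₄ α = 𝟏
β *₄ β = α

sumFin : (n : ℕ) → (Fin n → GF4) → GF4
sumFin zero    f = 𝟎
sumFin (suc n) f = f Fin.zero +₄ sumFin n (λ i → f (Fin.suc i))

sumMaybe : (n : ℕ) → (Maybe (Fin n) → GF4) → GF4
sumMaybe n f = f nothing +₄ sumFin n (λ i → f (just i))

-- Labelling conventions.
--  * Row labels (= the basis B):      Maybe (Fin k);  just i ↦ element i of X − e,
--                                                     nothing ↦ f.
--  * Column labels (= E − B):          Maybe (Fin m);  just j ↦ element j of (E − X) − f,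
--                                                     nothing ↦ e.
--  * Ground set E = B ⊔ (E − B).

Row : ℕ → Set
Row k = Maybe (Fin k)

Col : ℕ → Set
Col m = Maybe (Fin m)

data Elt (k m : ℕ) : Set where
  rowEl : Row k → Elt k m
  colEl : Col m → Elt k m

sumElt : ∀ {k m} → (Elt k m → GF4) → GF4
sumElt {k} {m} f = sumMaybe k (λ r → f (rowEl r)) +₄ sumMaybe m (λ c → f (colEl c))

Mat : ℕ → ℕ → Set
Mat k m = Row k → Col m → GF4

block : ∀ {k m} → (Fin k → Fin m → GF4) → GF4 → Mat k m
block A z (just i) (just j) = A i j
block A z (just i) nothing  = 𝟏
block A z nothing  (just j) = 𝟏
block A z nothing  nothing  = z

δ : ∀ {k} → Row k → Row k → GF4
δ nothing  nothing  = 𝟏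
δ nothing  (just _) = 𝟎
δ (just _) nothing  = 𝟎
δ (just i) (just j) with i ≟ j
... | yes _ = 𝟏
... | no  _ = 𝟎

column : ∀ {k m} → Mat k m → Elt k m → Row k → GF4
column C (rowEl r) r' = δ r r'
column C (colEl c) r' = C r' c

Subset : ℕ → ℕ → Set
Subset k m = Elt k m → Bool

_⊆_ : ∀ {k m} → Subset k m → Subset k m → Set
S ⊆ T = ∀ x → S x ≡ true → T x ≡ true

_≐_ : ∀ {k m} → Subset k m → Subset k m → Set
S ≐ T = ∀ x → S x ≡ T x

_⊂_ : ∀ {k m} → Subset k m → Subset k m → Set
S ⊂ T = S ⊆ T × Σ _ (λ x → T x ≡ true × S x ≡ false)

Independent : ∀ {k m} → Mat k m → Subset k m → Set
Independent C S =
  (c : _ → GF4) →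
  (∀ x → S x ≡ false → c x ≡ 𝟎) →
  (∀ r → sumElt (λ x → c x *₄ column C x r) ≡ 𝟎) →
  ∀ x → c x ≡ 𝟎

IsBasis : ∀ {k m} → Mat k m → Subset k m → Set
IsBasis C S = Independent C S × (∀ T → S ⊂ T → ¬ Independent C T)

IsCircuit : ∀ {k m} → Mat k m → Subset k m → Set
IsCircuit C S = ¬ Independent C S × (∀ T → T ⊂ S → Independent C T)

Spanning : ∀ {k m} → Mat k m → Subset k m → Set
Spanning C S = Σ (Subset _ _) (λ T → T ⊆ S × IsBasis C T)

IsHyperplane : ∀ {k m} → Mat k m → Subset k m → Set
IsHyperplane C S = ¬ Spanning C S × (∀ T → S ⊂ T → Spanning C T)

IsCircuitHyperplane : ∀ {k m} → Mat k m → Subset k m → Set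
IsCircuitHyperplane C S = IsCircuit C S × IsHyperplane C S

Xset : ∀ {k m} → Subset k m
Xset (rowEl (just _)) = true
Xset (rowEl nothing)  = false
Xset (colEl (just _)) = false
Xset (colEl nothing)  = true

Bset : ∀ {k m} → Subset k m
Bset (rowEl _) = true
Bset (colEl _) = false

-- Pivoting: the set obtained from B = rows by exchanging the row r for the column c is a basis
-- of M[I | C] exactly when C r c ≠ 0. For r ∈ X − e this set still contains f, so it is not X;
-- relaxing X therefore does not change whether it is a basis, and A i j, A' i j vanish together.
module Submission where

open import Defs
open import Data.Nat using (ℕ; suc)
open import Data.Fin using (Fin; zero; suc; punchIn)
open import Data.Fin.Properties as Fin using (punchInᵢ≢i)
open import Data.Maybe using (Maybe; just; nothing)
open import Data.Maybe.Properties as Maybe using ()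
open import Data.Bool using (true; false; not)
open import Data.Product using (_×_; _,_; proj₁; proj₂)
open import Data.Sum using (_⊎_; inj₁; [_,_]′)
open import Function using (id; _∘_)
open import Level using (0ℓ)
open import Relation.Nullary using (¬_; yes; no; does; contradiction)
open import Relation.Nullary.Decidable
  using (Dec; map′; from-yes; decidable-stable; dec-true; dec-false; _×-dec_; _⊎-dec_; _→-dec_)
open import Relation.Unary as U using ()
open import Relation.Binary.Definitions using (DecidableEquality)
open import Relation.Binary.PropositionalEquality
  using (_≡_; _≢_; refl; sym; trans; cong; cong₂; isEquivalence; module ≡-Reasoning)
open import Algebra.Definitions {A = GF4} _≡_
open import Algebra.Structures {A = GF4} _≡_
open import Algebra.Structures.Biased {A = GF4} _≡_ using (IsCommutativeMonoidˡ; IsCommutativeSemiringˡ)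
open import Algebra.Bundles using (CommutativeSemiring)

open ≡-Reasoning

toFin : GF4 → Fin 4
toFin 𝟎 = zero
toFin 𝟏 = suc zero
toFin α = suc (suc zero)
toFin β = suc (suc (suc zero))

fromFin : Fin 4 → GF4
fromFin zero                   = 𝟎
fromFin (suc zero)             = 𝟏
fromFin (suc (suc zero))       = α
fromFin (suc (suc (suc zero))) = β

fromFin-toFin : ∀ x → fromFin (toFin x) ≡ x
fromFin-toFin 𝟎 = refl
fromFin-toFin 𝟏 = refl
fromFin-toFin α = refl
fromFin-toFin β = refl

infix 4 _≟₄_

_≟₄_ : DecidableEquality GF4
x ≟₄ y = map′ toFin-injective (cong toFin) (toFin x Fin.≟ toFin y)
  where
  toFin-injective : toFin x ≡ toFin y → x ≡ y
  toFin-injective eq = begin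
    x                  ≡⟨ sym (fromFin-toFin x) ⟩
    fromFin (toFin x)  ≡⟨ cong fromFin eq ⟩
    fromFin (toFin y)  ≡⟨ fromFin-toFin y ⟩
    y                  ∎

-- GF(4) is finite, so its identities are decided by evaluating every case: from-yes (∀? …).
∀? : {P : GF4 → Set} → U.Decidable P → Dec (∀ x → P x)
∀? P? = map′ (λ (p𝟎 , p𝟏 , pα , pβ) → λ { 𝟎 → p𝟎 ; 𝟏 → p𝟏 ; α → pα ; β → pβ })
             (λ p → p 𝟎 , p 𝟏 , p α , p β)
             (P? 𝟎 ×-dec P? 𝟏 ×-dec P? α ×-dec P? β)

isCommutativeMonoid : ∀ {_∙_ ε} → Associative _∙_ → LeftIdentity ε _∙_ → Commutative _∙_ →
                      IsCommutativeMonoid _∙_ ε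
isCommutativeMonoid {_∙_} assoc identityˡ comm = IsCommutativeMonoidˡ.isCommutativeMonoid record
  { isSemigroup = record
    { isMagma = record { isEquivalence = isEquivalence ; ∙-cong = cong₂ _∙_ }
    ; assoc   = assoc
    }
  ; identityˡ = identityˡ
  ; comm      = comm
  }

+-*-commutativeSemiring : CommutativeSemiring 0ℓ 0ℓ
+-*-commutativeSemiring = record
  { Carrier = GF4
  ; _≈_     = _≡_
  ; _+_     = _+₄_
  ; _*_     = _*₄_
  ; 0#      = 𝟎
  ; 1#      = 𝟏
  ; isCommutativeSemiring = IsCommutativeSemiringˡ.isCommutativeSemiring record
    { +-isCommutativeMonoid = isCommutativeMonoid
        (from-yes (∀? λ x → ∀? λ y → ∀? λ z → (x +₄ y) +₄ z ≟₄ x +₄ (y +₄ z)))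
        (λ _ → refl)
        (from-yes (∀? λ x → ∀? λ y → x +₄ y ≟₄ y +₄ x))
    ; *-isCommutativeMonoid = isCommutativeMonoid
        (from-yes (∀? λ x → ∀? λ y → ∀? λ z → (x *₄ y) *₄ z ≟₄ x *₄ (y *₄ z)))
        (λ _ → refl)
        (from-yes (∀? λ x → ∀? λ y → x *₄ y ≟₄ y *₄ x))
    ; distribʳ = from-yes (∀? λ x → ∀? λ y → ∀? λ z → (y +₄ z) *₄ x ≟₄ y *₄ x +₄ z *₄ x)
    ; zeroˡ    = λ _ → refl
    }
  }

open CommutativeSemiring +-*-commutativeSemiring
  using (semiring; +-commutativeSemigroup; *-comm; *-assoc; *-identityʳ; distribˡ; distribʳ; zeroʳ; +-identityʳ)
open import Algebra.Properties.CommutativeSemigroup +-commutativeSemigroup using (interchange)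
open import Algebra.Properties.Semiring.Sum semiring
  using (sum; sum-cong-≗; sum-replicate-zero; sum-remove; ∑-distrib-+; *-distribˡ-sum)

x+x≡𝟎 : ∀ x → x +₄ x ≡ 𝟎
x+x≡𝟎 = from-yes (∀? λ x → x +₄ x ≟₄ 𝟎)

x+y≡𝟎⇒x≡y : ∀ {x y} → x +₄ y ≡ 𝟎 → x ≡ y
x+y≡𝟎⇒x≡y {x} {y} = from-yes (∀? λ x → ∀? λ y → x +₄ y ≟₄ 𝟎 →-dec x ≟₄ y) x y

x*y≡𝟎⇒x≡𝟎⊎y≡𝟎 : ∀ {x y} → x *₄ y ≡ 𝟎 → x ≡ 𝟎 ⊎ y ≡ 𝟎
x*y≡𝟎⇒x≡𝟎⊎y≡𝟎 {x} {y} = from-yes (∀? λ x → ∀? λ y → x *₄ y ≟₄ 𝟎 →-dec (x ≟₄ 𝟎 ⊎-dec y ≟₄ 𝟎)) x y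

sumFin≡sum : ∀ n (f : Fin n → GF4) → sumFin n f ≡ sum f
sumFin≡sum 0       f = refl
sumFin≡sum (suc n) f = cong (f zero +₄_) (sumFin≡sum n (f ∘ suc))

sum-zero : ∀ {n} (f : Fin n → GF4) → (∀ i → f i ≡ 𝟎) → sum f ≡ 𝟎
sum-zero {n} f f≡𝟎 = trans (sum-cong-≗ f≡𝟎) (sum-replicate-zero n)

sum-select : ∀ {n} (f : Fin n → GF4) p → (∀ i → i ≢ p → f i ≡ 𝟎) → sum f ≡ f p
sum-select {suc n} f p f≡𝟎 = begin
  sum f                              ≡⟨ sum-remove f ⟩
  f p +₄ sum (λ i → f (punchIn p i)) ≡⟨ cong (f p +₄_) (sum-zero _ λ i → f≡𝟎 _ (punchInᵢ≢i p i)) ⟩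
  f p +₄ 𝟎                           ≡⟨ +-identityʳ (f p) ⟩
  f p                                ∎

sumMaybe-select : ∀ n (f : Maybe (Fin n) → GF4) p → (∀ i → i ≢ p → f i ≡ 𝟎) → sumMaybe n f ≡ f p
sumMaybe-select n f nothing f≡𝟎 = begin
  f nothing +₄ sumFin n (f ∘ just) ≡⟨ cong (f nothing +₄_) (trans (sumFin≡sum n _) (sum-zero _ λ i → f≡𝟎 (just i) λ ())) ⟩
  f nothing +₄ 𝟎                   ≡⟨ +-identityʳ (f nothing) ⟩
  f nothing                        ∎
sumMaybe-select n f (just p) f≡𝟎 = begin
  f nothing +₄ sumFin n (f ∘ just) ≡⟨ cong (_+₄ sumFin n (f ∘ just)) (f≡𝟎 nothing λ ()) ⟩
  sumFin n (f ∘ just)              ≡⟨ sumFin≡sum n _ ⟩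
  sum (f ∘ just)                   ≡⟨ sum-select _ p (λ i i≢p → f≡𝟎 (just i) (i≢p ∘ Maybe.just-injective)) ⟩
  f (just p)                       ∎

-- sumMaybe n f is, by definition, sumFin (suc n) (f ∘ toMaybe).
toMaybe : ∀ {n} → Fin (suc n) → Maybe (Fin n)
toMaybe zero    = nothing
toMaybe (suc i) = just i

sumElt≡sum+sum : ∀ {k m} (f : Elt k m → GF4) →
                 sumElt f ≡ sum (λ i → f (rowEl (toMaybe i))) +₄ sum (λ j → f (colEl (toMaybe j)))
sumElt≡sum+sum {k} {m} f =
  cong₂ _+₄_ (sumFin≡sum (suc k) (f ∘ rowEl ∘ toMaybe)) (sumFin≡sum (suc m) (f ∘ colEl ∘ toMaybe))

sumElt-cong : ∀ {k m} {f g : Elt k m → GF4} → (∀ x → f x ≡ g x) → sumElt f ≡ sumElt g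
sumElt-cong {f = f} {g} f≗g = begin
  sumElt f                                               ≡⟨ sumElt≡sum+sum f ⟩
  sum (f ∘ rowEl ∘ toMaybe) +₄ sum (f ∘ colEl ∘ toMaybe) ≡⟨ cong₂ _+₄_ (sum-cong-≗ (f≗g ∘ rowEl ∘ toMaybe))
                                                                        (sum-cong-≗ (f≗g ∘ colEl ∘ toMaybe)) ⟩
  sum (g ∘ rowEl ∘ toMaybe) +₄ sum (g ∘ colEl ∘ toMaybe) ≡⟨ sym (sumElt≡sum+sum g) ⟩
  sumElt g                                               ∎

sumElt-+ : ∀ {k m} (f g : Elt k m → GF4) → sumElt (λ x → f x +₄ g x) ≡ sumElt f +₄ sumElt g
sumElt-+ f g = begin
  sumElt (λ x → f x +₄ g x)                            ≡⟨ sumElt≡sum+sum (λ x → f x +₄ g x) ⟩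
  sum (λ i → fr i +₄ gr i) +₄ sum (λ j → fc j +₄ gc j) ≡⟨ cong₂ _+₄_ (∑-distrib-+ fr gr) (∑-distrib-+ fc gc) ⟩
  (sum fr +₄ sum gr) +₄ (sum fc +₄ sum gc)             ≡⟨ interchange (sum fr) (sum gr) (sum fc) (sum gc) ⟩
  (sum fr +₄ sum fc) +₄ (sum gr +₄ sum gc)             ≡⟨ sym (cong₂ _+₄_ (sumElt≡sum+sum f) (sumElt≡sum+sum g)) ⟩
  sumElt f +₄ sumElt g                                 ∎
  where
  fr = f ∘ rowEl ∘ toMaybe
  fc = f ∘ colEl ∘ toMaybe
  gr = g ∘ rowEl ∘ toMaybe
  gc = g ∘ colEl ∘ toMaybe

*-distribˡ-sumElt : ∀ {k m} a (f : Elt k m → GF4) → a *₄ sumElt f ≡ sumElt (λ x → a *₄ f x)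
*-distribˡ-sumElt a f = begin
  a *₄ sumElt f                                         ≡⟨ cong (a *₄_) (sumElt≡sum+sum f) ⟩
  a *₄ (sum fr +₄ sum fc)                               ≡⟨ distribˡ a (sum fr) (sum fc) ⟩
  a *₄ sum fr +₄ a *₄ sum fc                            ≡⟨ cong₂ _+₄_ (*-distribˡ-sum a fr) (*-distribˡ-sum a fc) ⟩
  sum (λ i → a *₄ fr i) +₄ sum (λ j → a *₄ fc j)        ≡⟨ sym (sumElt≡sum+sum (λ x → a *₄ f x)) ⟩
  sumElt (λ x → a *₄ f x)                               ∎
  where
  fr = f ∘ rowEl ∘ toMaybe
  fc = f ∘ colEl ∘ toMaybe

δ-refl : ∀ {n} (p : Maybe (Fin n)) → δ p p ≡ 𝟏
δ-refl nothing = refl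
δ-refl (just i) with i Fin.≟ i
... | yes _  = refl
... | no i≢i = contradiction refl i≢i

δ-≢ : ∀ {n} {p q : Maybe (Fin n)} → p ≢ q → δ p q ≡ 𝟎
δ-≢ {p = nothing} {nothing} p≢q = contradiction refl p≢q
δ-≢ {p = nothing} {just _}  _   = refl
δ-≢ {p = just _}  {nothing} _   = refl
δ-≢ {p = just i}  {just j}  p≢q with i Fin.≟ j
... | yes i≡j = contradiction (cong just i≡j) p≢q
... | no _    = refl

sumMaybe-δ : ∀ n p (f : Maybe (Fin n) → GF4) → sumMaybe n (λ q → δ p q *₄ f q) ≡ f p
sumMaybe-δ n p f = begin
  sumMaybe n (λ q → δ p q *₄ f q) ≡⟨ sumMaybe-select n _ p (λ q q≢p → cong (_*₄ f q) (δ-≢ (q≢p ∘ sym))) ⟩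
  δ p p *₄ f p                    ≡⟨ cong (_*₄ f p) (δ-refl p) ⟩
  f p                             ∎

combination : ∀ {k m} → Mat k m → (Elt k m → GF4) → Row k → GF4
combination C v r = sumElt (λ x → v x *₄ column C x r)

InKernel : ∀ {k m} → Mat k m → (Elt k m → GF4) → Set
InKernel C v = ∀ r → combination C v r ≡ 𝟎

combination-expand : ∀ {k m} (C : Mat k m) v r →
                     combination C v r ≡ v (rowEl r) +₄ sumMaybe m (λ c → v (colEl c) *₄ C r c)
combination-expand {k} {m} C v r = cong (_+₄ sumMaybe m (λ c → v (colEl c) *₄ C r c)) (begin
  sumMaybe k (λ r' → v (rowEl r') *₄ δ r' r) ≡⟨ sumMaybe-select k _ r (λ r' r'≢r →
                                                  trans (cong (v (rowEl r') *₄_) (δ-≢ r'≢r)) (zeroʳ _)) ⟩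
  v (rowEl r) *₄ δ r r                        ≡⟨ cong (v (rowEl r) *₄_) (δ-refl r) ⟩
  v (rowEl r) *₄ 𝟏                            ≡⟨ *-identityʳ _ ⟩
  v (rowEl r)                                 ∎)

-- The coefficients of the fundamental circuit of column c with respect to B (no signs: GF(4) has characteristic 2).
fundamental : ∀ {k m} → Mat k m → Col m → Elt k m → GF4
fundamental C c (rowEl r)  = C r c
fundamental C c (colEl c') = δ c c'

fundamental-inKernel : ∀ {k m} (C : Mat k m) c → InKernel C (fundamental C c)
fundamental-inKernel {m = m} C c r = begin
  combination C (fundamental C c) r                 ≡⟨ combination-expand C (fundamental C c) r ⟩
  C r c +₄ sumMaybe m (λ c' → δ c c' *₄ C r c')     ≡⟨ cong (C r c +₄_) (sumMaybe-δ m c (C r)) ⟩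
  C r c +₄ C r c                                    ≡⟨ x+x≡𝟎 (C r c) ⟩
  𝟎                                                 ∎

inKernel-linear : ∀ {k m} (C : Mat k m) v w a b → InKernel C v → InKernel C w →
                  InKernel C (λ x → a *₄ v x +₄ b *₄ w x)
inKernel-linear C v w a b v∈ker w∈ker r = begin
  sumElt (λ x → (a *₄ v x +₄ b *₄ w x) *₄ col x)              ≡⟨ sumElt-cong distribute ⟩
  sumElt (λ x → a *₄ (v x *₄ col x) +₄ b *₄ (w x *₄ col x))   ≡⟨ sumElt-+ (λ x → a *₄ (v x *₄ col x)) (λ x → b *₄ (w x *₄ col x)) ⟩
  sumElt (λ x → a *₄ (v x *₄ col x)) +₄
  sumElt (λ x → b *₄ (w x *₄ col x))                          ≡⟨ sym (cong₂ _+₄_ (*-distribˡ-sumElt a (λ x → v x *₄ col x))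
                                                                                    (*-distribˡ-sumElt b (λ x → w x *₄ col x))) ⟩
  a *₄ combination C v r +₄ b *₄ combination C w r            ≡⟨ cong₂ (λ s t → a *₄ s +₄ b *₄ t) (v∈ker r) (w∈ker r) ⟩
  a *₄ 𝟎 +₄ b *₄ 𝟎                                            ≡⟨ cong₂ _+₄_ (zeroʳ a) (zeroʳ b) ⟩
  𝟎                                                           ∎
  where
  col : _ → GF4
  col x = column C x r
  distribute : ∀ x → (a *₄ v x +₄ b *₄ w x) *₄ col x ≡ a *₄ (v x *₄ col x) +₄ b *₄ (w x *₄ col x)
  distribute x = trans (distribʳ (col x) (a *₄ v x) (b *₄ w x))
                       (cong₂ _+₄_ (*-assoc a (v x) (col x)) (*-assoc b (w x) (col x)))

infix 4 _≟ᴹ_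

_≟ᴹ_ : ∀ {n} → DecidableEquality (Maybe (Fin n))
_≟ᴹ_ = Maybe.≡-dec Fin._≟_

pivotSet : ∀ {k m} → Row k → Col m → Subset k m
pivotSet r c (rowEl r') = not (does (r' ≟ᴹ r))
pivotSet r c (colEl c') = does (c' ≟ᴹ c)

⊆-∉ : ∀ {k m} {S T : Subset k m} {x} → S ⊆ T → T x ≡ false → S x ≡ false
⊆-∉ {S = S} {x = x} S⊆T x∉T with S x in x∈?S
... | false = refl
... | true  = contradiction (trans (sym (S⊆T x x∈?S)) x∉T) λ ()

data OutsidePivot {k m} (r : Row k) (c : Col m) : Elt k m → Set where
  pivot-row : OutsidePivot r c (rowEl r)
  other-col : ∀ {c'} → c' ≢ c → OutsidePivot r c (colEl c')

module _ {k m} {r : Row k} {c : Col m} where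

  outsidePivot : ∀ x → pivotSet r c x ≡ false → OutsidePivot r c x
  outsidePivot (rowEl r') x∉ with r' ≟ᴹ r
  ... | yes refl = pivot-row
  outsidePivot (rowEl r') () | no _
  outsidePivot (colEl c') x∉ with c' ≟ᴹ c
  outsidePivot (colEl c') () | yes _
  ... | no c'≢c = other-col c'≢c

  outsidePivot⁻¹ : ∀ {x} → OutsidePivot r c x → pivotSet r c x ≡ false
  outsidePivot⁻¹ pivot-row        = cong not (dec-true (r ≟ᴹ r) refl)
  outsidePivot⁻¹ (other-col c'≢c) = dec-false (_ ≟ᴹ c) c'≢c

module _ {k m} (C : Mat k m) (r : Row k) (c : Col m) where

  pivotSet-independent : C r c ≢ 𝟎 → Independent C (pivotSet r c)
  pivotSet-independent Crc≢𝟎 v v-supp v∈ker = v≡𝟎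
    where
    outside≡𝟎 : ∀ {x} → OutsidePivot r c x → v x ≡ 𝟎
    outside≡𝟎 o = v-supp _ (outsidePivot⁻¹ o)

    row≡ : ∀ r' → v (rowEl r') ≡ v (colEl c) *₄ C r' c
    row≡ r' = x+y≡𝟎⇒x≡y (begin
      v (rowEl r') +₄ v (colEl c) *₄ C r' c                     ≡⟨ cong (v (rowEl r') +₄_) (sym (sumMaybe-select m _ c λ c' c'≢c →
                                                                     cong (_*₄ C r' c') (outside≡𝟎 (other-col c'≢c)))) ⟩
      v (rowEl r') +₄ sumMaybe m (λ c' → v (colEl c') *₄ C r' c') ≡⟨ sym (combination-expand C v r') ⟩
      combination C v r'                                          ≡⟨ v∈ker r' ⟩
      𝟎                                                           ∎)

    col≡𝟎 : v (colEl c) ≡ 𝟎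
    col≡𝟎 = [ id , (λ Crc≡𝟎 → contradiction Crc≡𝟎 Crc≢𝟎) ]′
              (x*y≡𝟎⇒x≡𝟎⊎y≡𝟎 (trans (sym (row≡ r)) (outside≡𝟎 pivot-row)))

    v≡𝟎 : ∀ x → v x ≡ 𝟎
    v≡𝟎 (rowEl r') = trans (row≡ r') (cong (_*₄ C r' c) col≡𝟎)
    v≡𝟎 (colEl c') with c' ≟ᴹ c
    ... | yes refl = col≡𝟎
    ... | no c'≢c  = outside≡𝟎 (other-col c'≢c)

  pivotSet-dependent : C r c ≡ 𝟎 → ¬ Independent C (pivotSet r c)
  pivotSet-dependent Crc≡𝟎 indep = contradiction
    (trans (sym (δ-refl c)) (indep (fundamental C c) supp (fundamental-inKernel C c) (colEl c))) λ ()
    where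
    supp : ∀ x → pivotSet r c x ≡ false → fundamental C c x ≡ 𝟎
    supp x x∉ with outsidePivot x x∉
    ... | pivot-row      = Crc≡𝟎
    ... | other-col c'≢c = δ-≢ (c'≢c ∘ sym)

  pivotSet-maximal : C r c ≢ 𝟎 → ∀ T → pivotSet r c ⊂ T → ¬ Independent C T
  pivotSet-maximal Crc≢𝟎 T (S⊆T , x , x∈T , x∉S) indep with outsidePivot x x∉S
  ... | pivot-row = contradiction
    (trans (sym (δ-refl c)) (indep (fundamental C c) supp (fundamental-inKernel C c) (colEl c))) λ ()
    where
    supp : ∀ y → T y ≡ false → fundamental C c y ≡ 𝟎
    supp y y∉T with outsidePivot y (⊆-∉ S⊆T y∉T)
    ... | pivot-row      = contradiction (trans (sym x∈T) y∉T) λ ()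
    ... | other-col c'≢c = δ-≢ (c'≢c ∘ sym)
  ... | other-col {c'} c'≢c = Crc≢𝟎 (trans (sym v-at-c') (indep v supp v∈ker (colEl c')))
    where
    -- a dependency inside B − r + c + c', with coefficient C r c at c' and none at r
    v : Elt k m → GF4
    v y = C r c *₄ fundamental C c' y +₄ C r c' *₄ fundamental C c y

    v∈ker : InKernel C v
    v∈ker = inKernel-linear C (fundamental C c') (fundamental C c) (C r c) (C r c')
                            (fundamental-inKernel C c') (fundamental-inKernel C c)

    v-at-c' : v (colEl c') ≡ C r c
    v-at-c' = begin
      C r c *₄ δ c' c' +₄ C r c' *₄ δ c c'  ≡⟨ cong₂ (λ s t → C r c *₄ s +₄ C r c' *₄ t) (δ-refl c') (δ-≢ (c'≢c ∘ sym)) ⟩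
      C r c *₄ 𝟏 +₄ C r c' *₄ 𝟎            ≡⟨ cong₂ _+₄_ (*-identityʳ (C r c)) (zeroʳ (C r c')) ⟩
      C r c +₄ 𝟎                           ≡⟨ +-identityʳ (C r c) ⟩
      C r c                                ∎

    supp : ∀ y → T y ≡ false → v y ≡ 𝟎
    supp y y∉T with outsidePivot y (⊆-∉ S⊆T y∉T)
    ... | pivot-row = trans (cong (_+₄ C r c' *₄ C r c) (*-comm (C r c) (C r c'))) (x+x≡𝟎 (C r c' *₄ C r c))
    ... | other-col {c''} c''≢c with c'' ≟ᴹ c'
    ...   | yes refl  = contradiction (trans (sym x∈T) y∉T) λ ()
    ...   | no c''≢c' = begin
      C r c *₄ δ c' c'' +₄ C r c' *₄ δ c c''  ≡⟨ cong₂ (λ s t → C r c *₄ s +₄ C r c' *₄ t) (δ-≢ (c''≢c' ∘ sym)) (δ-≢ (c''≢c ∘ sym)) ⟩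
      C r c *₄ 𝟎 +₄ C r c' *₄ 𝟎              ≡⟨ cong₂ _+₄_ (zeroʳ (C r c)) (zeroʳ (C r c')) ⟩
      𝟎                                      ∎

  pivotSet-isBasis : C r c ≢ 𝟎 → IsBasis C (pivotSet r c)
  pivotSet-isBasis Crc≢𝟎 = pivotSet-independent Crc≢𝟎 , pivotSet-maximal Crc≢𝟎

  pivotSet-isBasis⁻¹ : IsBasis C (pivotSet r c) → C r c ≢ 𝟎
  pivotSet-isBasis⁻¹ (indep , _) Crc≡𝟎 = pivotSet-dependent Crc≡𝟎 indep

pivotSet≉Xset : ∀ {k m} {i : Fin k} {c : Col m} → ¬ pivotSet (just i) c ≐ Xset
pivotSet≉Xset S≐X = contradiction (S≐X (rowEl nothing)) λ ()

lemma6p1 : (k m : ℕ) (A A' : Fin k → Fin m → GF4) (ω : GF4) →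
    ¬ (ω ≡ 𝟎) → ¬ (ω ≡ 𝟏) →
    IsCircuitHyperplane (block A 𝟎) Xset →
    IsBasis (block A 𝟎) Bset →
    (∀ S → (IsBasis (block A' ω) S → IsBasis (block A 𝟎) S ⊎ S ≐ Xset)
         × (IsBasis (block A 𝟎) S ⊎ S ≐ Xset → IsBasis (block A' ω) S)) →
    (i : Fin k) (j : Fin m) →
    (A i j ≡ 𝟎 → A' i j ≡ 𝟎) × (A' i j ≡ 𝟎 → A i j ≡ 𝟎)
lemma6p1 k m A A' ω _ _ _ _ relaxation i j = zero-preserved , zero-reflected
  where
  S : Subset k m
  S = pivotSet (just i) (just j)

  zero-preserved : A i j ≡ 𝟎 → A' i j ≡ 𝟎
  zero-preserved Aij≡𝟎 = decidable-stable (A' i j ≟₄ 𝟎) λ A'ij≢𝟎 →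
    [ (λ S-basis → pivotSet-isBasis⁻¹ (block A 𝟎) (just i) (just j) S-basis Aij≡𝟎) , pivotSet≉Xset ]′
      (proj₁ (relaxation S) (pivotSet-isBasis (block A' ω) (just i) (just j) A'ij≢𝟎))

  zero-reflected : A' i j ≡ 𝟎 → A i j ≡ 𝟎
  zero-reflected A'ij≡𝟎 = decidable-stable (A i j ≟₄ 𝟎) λ Aij≢𝟎 →
    pivotSet-isBasis⁻¹ (block A' ω) (just i) (just j)
      (proj₂ (relaxation S) (inj₁ (pivotSet-isBasis (block A 𝟎) (just i) (just j) Aij≢𝟎))) A'ij≡𝟎
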